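{- Let $k\ge 2$ and $n>3k-3$ be integers. Then there is no graph in $\mathfrak{Gr}(n,k)$. In other words, $\Xi(k)\le 3k-3$ for $k\ge 2$.
   Context: All graphs are finite, simple and undirected. For a graph $G=(V,E)$ and $x\in V$, $N[x]=\{x\}\cup\{y: xy\in E\}$. A set $C\subseteq V$ is identifying if $N[x]\cap C\ne\emptyset$ for every $x\in V$ and $N[x]\cap C\neq N[y]\cap C$ for all distinct $x,y\in V$. For $n\ge k\ge1$, $\mathfrak{Gr}(n,k)$ is the set of graphs on $n$ vertices in which every $k$-element subset of vertices is identifying, and $\Xi(k)=\max\{n\ge k:\mathfrak{Gr}(n,k)\ne\emptyset\}$. -}

module Defs where

open import Data.Nat using (ℕ)
open import Data.Bool using (Bool; true; false; _∨_)
open import Data.Fin using (Fin; _≟_)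
open import Data.Fin.Subset using (Subset; _∩_; ∣_∣; Empty; _∈_)
open import Data.Vec using (tabulate)
open import Relation.Nullary using (¬_; does)
open import Relation.Binary.PropositionalEquality using (_≡_; _≢_)
open import Data.Product using (_×_)

record Graph (n : ℕ) : Set where
  field
    adj     : Fin n → Fin n → Bool
    sym     : ∀ x y → adj x y ≡ adj y x
    irrefl  : ∀ x → adj x x ≡ false

open Graph public

N[_] : ∀ {n} → (G : Graph n) → Fin n → Subset n
N[_] G x = tabulate (λ y → does (x ≟ y) ∨ adj G x y)

IsIdentifying : ∀ {n} → Graph n → Subset n → Set
IsIdentifying {n} G C =
  (∀ (x : Fin n) → ¬ Empty (N[ G ] x ∩ C)) ×
  (∀ (x y : Fin n) → x ≢ y → (N[ G ] x ∩ C) ≢ (N[ G ] y ∩ C))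

InGr : (n k : ℕ) → Graph n → Set
InGr n k G = ∀ (C : Subset n) → ∣ C ∣ ≡ k → IsIdentifying G C

module Submission where

open import Defs hiding (sym)
open import Data.Nat using (ℕ; zero; suc; _+_; _*_; _∸_; _≤_; _<_; z≤n; s≤s; _≤?_)
open import Data.Nat.Properties
open import Data.Vec using ([]; _∷_)
open import Data.Fin using (Fin)
import Data.Fin as Fin
open import Data.Fin.Subset using (Subset; _∩_; _∪_; ∁; ∣_∣; Empty; _⊆_; ⊥; inside; outside)
open import Data.Fin.Subset.Properties
open import Algebra.Lattice.Properties.BooleanAlgebra using (deMorgan₁)
open import Data.Product using (∃-syntax; _×_; _,_; proj₁; proj₂)
open import Relation.Binary.PropositionalEquality using (_≡_; _≢_; sym; cong; module ≡-Reasoning)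
open import Relation.Nullary using (¬_; yes; no; contradiction)
open import Function using (_∘_)

-- Fix two distinct vertices x and y. No k non-neighbours of x may exist, else
-- they would miss N[x]; no k common neighbours of x and y may exist, else they
-- would not separate x from y. Every vertex is a common neighbour of x and y or a
-- non-neighbour of one of them, so n ≤ (k - 1) + (k - 1) + (k - 1).

private
  variable
    n k : ℕ

subset-of-size : ∀ (p : Subset n) → k ≤ ∣ p ∣ → ∃[ q ] q ⊆ p × ∣ q ∣ ≡ k
subset-of-size {n} {zero} p _ = ⊥ , ⊥⊆ , ∣⊥∣≡0 n
subset-of-size (outside ∷ p) k≤∣p∣ with subset-of-size p k≤∣p∣
... | q , q⊆p , ∣q∣≡k = outside ∷ q , out⊆ q⊆p , ∣q∣≡k
subset-of-size {k = suc k} (inside ∷ p) (s≤s k≤∣p∣) with subset-of-size p k≤∣p∣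
... | q , q⊆p , ∣q∣≡k = inside ∷ q , s⊆s q⊆p , cong suc ∣q∣≡k

∣p∪q∣≤∣p∣+∣q∣ : ∀ (p q : Subset n) → ∣ p ∪ q ∣ ≤ ∣ p ∣ + ∣ q ∣
∣p∪q∣≤∣p∣+∣q∣ []            []            = z≤n
∣p∪q∣≤∣p∣+∣q∣ (inside  ∷ p) (inside  ∷ q) =
  s≤s (≤-trans (∣p∪q∣≤∣p∣+∣q∣ p q) (+-monoʳ-≤ ∣ p ∣ (n≤1+n ∣ q ∣)))
∣p∪q∣≤∣p∣+∣q∣ (inside  ∷ p) (outside ∷ q) = s≤s (∣p∪q∣≤∣p∣+∣q∣ p q)
∣p∪q∣≤∣p∣+∣q∣ (outside ∷ p) (inside  ∷ q) =
  ≤-trans (s≤s (∣p∪q∣≤∣p∣+∣q∣ p q)) (≤-reflexive (sym (+-suc ∣ p ∣ ∣ q ∣)))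
∣p∪q∣≤∣p∣+∣q∣ (outside ∷ p) (outside ∷ q) = ∣p∪q∣≤∣p∣+∣q∣ p q

n≤∣p∩q∣+∣∁p∣+∣∁q∣ : ∀ (p q : Subset n) → n ≤ ∣ p ∩ q ∣ + ∣ ∁ p ∣ + ∣ ∁ q ∣
n≤∣p∩q∣+∣∁p∣+∣∁q∣ {n} p q = begin
  n                       ≡⟨ m+[n∸m]≡n (∣p∣≤n (p ∩ q)) ⟨
  ∣p∩q∣ + (n ∸ ∣p∩q∣)     ≡⟨ cong (∣p∩q∣ +_) (∣∁p∣≡n∸∣p∣ (p ∩ q)) ⟨
  ∣p∩q∣ + ∣ ∁ (p ∩ q) ∣   ≡⟨ cong (λ r → ∣p∩q∣ + ∣ r ∣) (deMorgan₁ (∪-∩-booleanAlgebra n) p q) ⟩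
  ∣p∩q∣ + ∣ ∁ p ∪ ∁ q ∣   ≤⟨ +-monoʳ-≤ ∣p∩q∣ (∣p∪q∣≤∣p∣+∣q∣ (∁ p) (∁ q)) ⟩
  ∣p∩q∣ + (∣∁p∣ + ∣∁q∣)   ≡⟨ +-assoc ∣p∩q∣ ∣∁p∣ ∣∁q∣ ⟨
  ∣p∩q∣ + ∣∁p∣ + ∣∁q∣     ∎
  where
  open ≤-Reasoning
  ∣p∩q∣ ∣∁p∣ ∣∁q∣ : ℕ
  ∣p∩q∣ = ∣ p ∩ q ∣
  ∣∁p∣ = ∣ ∁ p ∣
  ∣∁q∣ = ∣ ∁ q ∣

q⊆p⇒p∩q≡q : ∀ {p q : Subset n} → q ⊆ p → p ∩ q ≡ q
q⊆p⇒p∩q≡q {p = p} {q} q⊆p = ⊆-antisym (p∩q⊆q p q) (λ x∈q → x∈p∩q⁺ (q⊆p x∈q , x∈q))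

q⊆∁p⇒Empty[p∩q] : ∀ {p q : Subset n} → q ⊆ ∁ p → Empty (p ∩ q)
q⊆∁p⇒Empty[p∩q] {p = p} {q} q⊆∁p (x , x∈p∩q) =
  let x∈p , x∈q = x∈p∩q⁻ p q x∈p∩q in x∈∁p⇒x∉p (q⊆∁p x∈q) x∈p

a,b,c<k⇒a+b+c≤3*k∸3 : ∀ {a b c} → a < k → b < k → c < k → a + b + c ≤ 3 * k ∸ 3
a,b,c<k⇒a+b+c≤3*k∸3 {k = suc j} {a} {b} {c} (s≤s a≤j) (s≤s b≤j) (s≤s c≤j) = begin
  a + b + c     ≤⟨ +-mono-≤ (+-mono-≤ a≤j b≤j) c≤j ⟩
  j + j + j     ≡⟨ +-assoc j j j ⟩
  j + (j + j)   ≡⟨ cong (λ t → j + (j + t)) (+-identityʳ j) ⟨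
  3 * j         ≡⟨ *-distribˡ-∸ 3 (suc j) 1 ⟩
  3 * suc j ∸ 3 ∎
  where open ≤-Reasoning

∣∁N[x]∣<k : (G : Graph n) → InGr n k G → ∀ x → ∣ ∁ (N[ G ] x) ∣ < k
∣∁N[x]∣<k {k = k} G inGr x with k ≤? ∣ ∁ (N[ G ] x) ∣
... | no k≰∣∁N[x]∣ = ≰⇒> k≰∣∁N[x]∣
... | yes k≤∣∁N[x]∣ with subset-of-size (∁ (N[ G ] x)) k≤∣∁N[x]∣
... | C , C⊆∁N[x] , ∣C∣≡k = contradiction (q⊆∁p⇒Empty[p∩q] C⊆∁N[x]) (proj₁ (inGr C ∣C∣≡k) x)

∣N[x]∩N[y]∣<k : (G : Graph n) → InGr n k G → ∀ {x y} → x ≢ y → ∣ N[ G ] x ∩ N[ G ] y ∣ < k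
∣N[x]∩N[y]∣<k {k = k} G inGr {x} {y} x≢y with k ≤? ∣ N[ G ] x ∩ N[ G ] y ∣
... | no k≰∣N[x]∩N[y]∣ = ≰⇒> k≰∣N[x]∩N[y]∣
... | yes k≤∣N[x]∩N[y]∣ with subset-of-size (N[ G ] x ∩ N[ G ] y) k≤∣N[x]∩N[y]∣
... | C , C⊆N[x]∩N[y] , ∣C∣≡k = contradiction N[x]∩C≡N[y]∩C (proj₂ (inGr C ∣C∣≡k) x y x≢y)
  where
  open ≡-Reasoning
  N[x]∩C≡N[y]∩C : N[ G ] x ∩ C ≡ N[ G ] y ∩ C
  N[x]∩C≡N[y]∩C = begin
    N[ G ] x ∩ C ≡⟨ q⊆p⇒p∩q≡q (p∩q⊆p _ _ ∘ C⊆N[x]∩N[y]) ⟩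
    C            ≡⟨ q⊆p⇒p∩q≡q (p∩q⊆q _ _ ∘ C⊆N[x]∩N[y]) ⟨
    N[ G ] y ∩ C ∎

InGr⇒n≤3*k∸3 : ∀ {m} (G : Graph (2 + m)) → InGr (2 + m) k G → 2 + m ≤ 3 * k ∸ 3
InGr⇒n≤3*k∸3 G inGr = ≤-trans (n≤∣p∩q∣+∣∁p∣+∣∁q∣ (N[ G ] x) (N[ G ] y))
  (a,b,c<k⇒a+b+c≤3*k∸3 (∣N[x]∩N[y]∣<k G inGr x≢y) (∣∁N[x]∣<k G inGr x) (∣∁N[x]∣<k G inGr y))
  where
  x y : Fin _
  x = Fin.zero
  y = Fin.suc Fin.zero
  x≢y : x ≢ y
  x≢y ()

theorem12 : (k n : ℕ) → 2 ≤ k → 3 * k ∸ 3 < n → (G : Graph n) → ¬ InGr n k G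
theorem12 k zero          2≤k ()
theorem12 k (suc zero)    2≤k (s≤s 3k∸3≤0) G _ =
  contradiction (≤-trans (∸-monoˡ-≤ 3 (*-monoʳ-≤ 3 2≤k)) 3k∸3≤0) λ ()
theorem12 k (suc (suc m)) 2≤k 3k∸3<n G inGr = <⇒≱ 3k∸3<n (InGr⇒n≤3*k∸3 G inGr)
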